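{- Let $w$ be a double occurrence word in ascending order of length $n$, $\nu\ge1$, and let $\mathcal I_1(\nu,k_1,\ell_1)$, $\mathcal I_2(\nu,k_2,\ell_2)$ be insertions into $w$ with $w\star\mathcal I_1(\nu,k_1,\ell_1)\sim w\star\mathcal I_2(\nu,k_2,\ell_2)$, $k_1=1$ and $\ell_2=n+1$. If $k_1\le\ell_1<k_2\le\ell_2$, then $k_2-\ell_1\ge\nu$.
   Context: Alphabet $\Sigma=\mathbb{N}$; words are finite sequences over $\Sigma$, $|w|$ is length, $w^R$ the reverse. A double occurrence word (DOW) is a word in which every symbol occurs zero or exactly two times. An equivalence map is a morphism of $\Sigma^*$ induced by a bijection $\Sigma\to\Sigma$; $x\sim y$ means $f(x)=y$ for some equivalence map $f$. A word is in ascending order if it is empty or its first symbol is $1$ and the first occurrence of each symbol is one greater than the largest symbol preceding it. Insertions: for a DOW $w$ in ascending order with largest symbol $M$ ($M=0$ if $w$ is empty), $\nu\ge1$, $u=(M+1)\cdots(M+\nu)$ and $1\le k\le\ell\le|w|+1$, write $w=y_1y_2y_3$ with $|y_1|=k-1$, $|y_1y_2|=\ell-1$; the repeat insertion gives $w\star\rho(\nu,k,\ell)=y_1uy_2uy_3$ and the return insertion gives $w\star\tau(\nu,k,\ell)=y_1uy_2u^Ry_3$; $\mathcal I(\nu,k,\ell)$ denotes an insertion of either kind. -}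

module Defs where

open import Data.Nat using (ℕ; zero; suc; _+_; _∸_; _⊔_)
open import Data.List using (List; []; _∷_; _++_; [_]; take; drop; map; foldr; reverse; applyUpTo)
open import Data.List.Membership.Propositional using (_∉_)
open import Data.Product using (_×_; ∃)
open import Data.Sum using (_⊎_)
open import Data.Unit using (⊤)
open import Relation.Binary.PropositionalEquality using (_≡_)
open import Relation.Nullary using (Dec; yes; no)
open import Function.Bundles using (_⤖_; Bijection)
open import Data.Nat.Properties using (_≟_)

Word : Set
Word = List ℕ

count : ℕ → Word → ℕ
count a [] = 0
count a (x ∷ xs) with a ≟ x
... | yes _ = suc (count a xs)
... | no  _ = count a xs

DOW : Word → Set
DOW w = ∀ a → count a w ≡ 0 ⊎ count a w ≡ 2

maxSym : Word → ℕ
maxSym = foldr _⊔_ 0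

-- Ascending order: scanning left to right with the already-read prefix p,
-- every first occurrence of a symbol equals one more than the largest symbol
-- preceding it (so in particular a nonempty word starts with 1).
AscFrom : Word → Word → Set
AscFrom p [] = ⊤
AscFrom p (x ∷ xs) = (x ∉ p → x ≡ suc (maxSym p)) × AscFrom (p ++ [ x ]) xs

Ascending : Word → Set
Ascending w = AscFrom [] w

_∼_ : Word → Word → Set
x ∼ y = ∃ λ (f : ℕ ⤖ ℕ) → map (Bijection.to f) x ≡ y

data Kind : Set where
  repeat : Kind
  return : Kind

newSyms : ℕ → Word → Word
newSyms ν w = applyUpTo (λ i → maxSym w + suc i) ν

-- w ⋆ I(ν,k,ℓ) with w = y₁y₂y₃, |y₁| = k-1, |y₁y₂| = ℓ-1
insert : Kind → ℕ → ℕ → ℕ → Word → Word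
insert repeat ν k ℓ w =
  take (k ∸ 1) w ++ newSyms ν w ++ take (ℓ ∸ k) (drop (k ∸ 1) w) ++ newSyms ν w ++ drop (ℓ ∸ 1) w
insert return ν k ℓ w =
  take (k ∸ 1) w ++ newSyms ν w ++ take (ℓ ∸ k) (drop (k ∸ 1) w) ++ reverse (newSyms ν w) ++ drop (ℓ ∸ 1) w

-- Counting positions from 0, the first symbol of the second copy of u in w ⋆ I₁(ν, 1, ℓ₁),
-- at position ν + ℓ₁ - 1, already occurs in the first copy, at some position q < ν.
-- An equivalence map sends equal symbols to equal symbols, so positions q and ν + ℓ₁ - 1
-- of w ⋆ I₂(ν, k₂, ℓ₂) carry equal symbols too.  If k₂ - ℓ₁ < ν, position ν + ℓ₁ - 1 lies
-- in the first copy of u in w ⋆ I₂, whose symbols are fresh and pairwise distinct, while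
-- the earlier position q lies in the old prefix or earlier in that same copy.
module Submission where

open import Defs
open import Data.Nat using (ℕ; suc; _≤_; _<_; _≥_; _∸_)
open import Data.List using (length)
open import Relation.Binary.PropositionalEquality using (_≡_)

open import Data.Nat using (zero; _+_; _<?_; z<s; s≤s; s<s⁻¹; s≤s⁻¹)
open import Data.Nat.Properties
open import Data.List using (List; []; _∷_; _++_; take; drop; map; reverse; applyUpTo)
open import Data.List.Properties using (length-applyUpTo; length-take; reverse-applyUpTo)
open import Data.Maybe using (Maybe; just; nothing)
import Data.Maybe as Maybe
open import Data.Maybe.Properties using (just-injective)
open import Data.Product using (Σ-syntax; _×_; _,_)
open import Data.Empty using (⊥)
open import Relation.Nullary using (¬_; Dec; yes; no; contradiction)
open import Relation.Binary.PropositionalEquality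
  using (_≢_; refl; sym; trans; cong; subst; module ≡-Reasoning)
open import Function.Bundles using (Bijection)

private
  variable
    A B : Set

at : ℕ → List A → Maybe A
at _       []       = nothing
at zero    (x ∷ xs) = just x
at (suc i) (x ∷ xs) = at i xs

at-map : ∀ (g : A → B) i xs → at i (map g xs) ≡ Maybe.map g (at i xs)
at-map g i       []       = refl
at-map g zero    (x ∷ xs) = refl
at-map g (suc i) (x ∷ xs) = at-map g i xs

at-++ˡ : ∀ i (xs ys : List A) → i < length xs → at i (xs ++ ys) ≡ at i xs
at-++ˡ zero    (x ∷ xs) ys _   = refl
at-++ˡ (suc i) (x ∷ xs) ys i<n = at-++ˡ i xs ys (s<s⁻¹ i<n)

at-++ʳ : ∀ {a} i (xs ys : List A) → length xs ≡ a → at (a + i) (xs ++ ys) ≡ at i ys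
at-++ʳ i []       ys refl = refl
at-++ʳ i (x ∷ xs) ys refl = at-++ʳ i xs ys refl

at-applyUpTo : ∀ (f : ℕ → A) {n i} → i < n → at i (applyUpTo f n) ≡ just (f i)
at-applyUpTo f {suc n} {zero}  _   = refl
at-applyUpTo f {suc n} {suc i} i<n = at-applyUpTo (λ j → f (suc j)) (s<s⁻¹ i<n)

at-take⇒≤maxSym : ∀ i K xs {b} → at i (take K xs) ≡ just b → b ≤ maxSym xs
at-take⇒≤maxSym zero    (suc K) (x ∷ xs) refl = m≤m⊔n x (maxSym xs)
at-take⇒≤maxSym (suc i) (suc K) (x ∷ xs) eq   =
  ≤-trans (at-take⇒≤maxSym i K xs eq) (m≤n⊔m x (maxSym xs))

length-take-≤ : ∀ {K} (xs : List A) → K ≤ length xs → length (take K xs) ≡ K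
length-take-≤ {K = K} xs K≤n = trans (length-take K xs) (m≤n⇒m⊓n≡m K≤n)

∼-preserves-repetition : ∀ {x y : Word} i j → x ∼ y → at i x ≡ at j x → at i y ≡ at j y
∼-preserves-repetition {x} i j (f , refl) eq = begin
  at i (map g x)       ≡⟨ at-map g i x ⟩
  Maybe.map g (at i x) ≡⟨ cong (Maybe.map g) eq ⟩
  Maybe.map g (at j x) ≡⟨ sym (at-map g j x) ⟩
  at j (map g x)       ∎
  where
  open ≡-Reasoning
  g = Bijection.to f

secondCopy : Kind → ℕ → Word → Word
secondCopy repeat ν w = newSyms ν w
secondCopy return ν w = reverse (newSyms ν w)

insert-shape : ∀ I ν k ℓ w → insert I ν k ℓ w ≡
  take (k ∸ 1) w ++ newSyms ν w ++ take (ℓ ∸ k) (drop (k ∸ 1) w) ++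
  secondCopy I ν w ++ drop (ℓ ∸ 1) w
insert-shape repeat ν k ℓ w = refl
insert-shape return ν k ℓ w = refl

length-newSyms : ∀ ν w → length (newSyms ν w) ≡ ν
length-newSyms ν w = length-applyUpTo (λ i → maxSym w + suc i) ν

at-newSyms : ∀ {ν i} w ys → i < ν → at i (newSyms ν w ++ ys) ≡ just (maxSym w + suc i)
at-newSyms {ν} {i} w ys i<ν = begin
  at i (newSyms ν w ++ ys) ≡⟨ at-++ˡ i (newSyms ν w) ys i<length ⟩
  at i (newSyms ν w)       ≡⟨ at-applyUpTo (λ j → maxSym w + suc j) i<ν ⟩
  just (maxSym w + suc i)  ∎
  where
  open ≡-Reasoning
  i<length = subst (i <_) (sym (length-newSyms ν w)) i<ν

secondCopy-head : ∀ I m w → Σ[ q ∈ ℕ ] q < suc m ×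
  (∀ ys → at 0 (secondCopy I (suc m) w ++ ys) ≡ just (maxSym w + suc q))
secondCopy-head repeat m w = 0 , z<s , λ ys → refl
secondCopy-head return m w = m , ≤-refl , λ ys →
  cong (λ zs → at 0 (zs ++ ys)) (reverse-applyUpTo (λ j → maxSym w + suc j) (suc m))

insertAtStart-repeats : ∀ I m L w → L ≤ length w →
  Σ[ q ∈ ℕ ] q < suc m × (let W = insert I (suc m) 1 (suc L) w in at q W ≡ at (suc m + L) W)
insertAtStart-repeats I m L w L≤n with secondCopy-head I m w
... | q , q<ν , head = q , q<ν , (begin
  at q W                     ≡⟨ cong (at q) shape ⟩
  at q (u ++ rest)           ≡⟨ at-newSyms w rest q<ν ⟩
  just (maxSym w + suc q)    ≡⟨ sym (head (drop L w)) ⟩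
  at 0 (copy ++ drop L w)    ≡⟨ sym (at-++ʳ 0 (take L w) _ (length-take-≤ w L≤n)) ⟩
  at (L + 0) rest            ≡⟨ cong (λ i → at i rest) (+-identityʳ L) ⟩
  at L rest                  ≡⟨ sym (at-++ʳ L u rest (length-newSyms (suc m) w)) ⟩
  at (suc m + L) (u ++ rest) ≡⟨ cong (at (suc m + L)) (sym shape) ⟩
  at (suc m + L) W           ∎)
  where
  open ≡-Reasoning
  W    = insert I (suc m) 1 (suc L) w
  u    = newSyms (suc m) w
  copy = secondCopy I (suc m) w
  rest = take L w ++ copy ++ drop L w
  shape : W ≡ u ++ rest
  shape = insert-shape I (suc m) 1 (suc L) w

module _ (I : Kind) (ν K ℓ : ℕ) (w : Word) (K≤n : K ≤ length w) where

  private
    W = insert I ν (suc K) ℓ w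
    u = newSyms ν w
    rest = take (ℓ ∸ suc K) (drop K w) ++ secondCopy I ν w ++ drop (ℓ ∸ 1) w

    shape : W ≡ take K w ++ u ++ rest
    shape = insert-shape I ν (suc K) ℓ w

    length-prefix : length (take K w) ≡ K
    length-prefix = length-take-≤ w K≤n

  at-insert-fresh : ∀ k → K ≤ k → k < K + ν → at k W ≡ just (maxSym w + suc (k ∸ K))
  at-insert-fresh k K≤k k<K+ν = begin
    at k W                           ≡⟨ cong (λ i → at i W) (sym (m+[n∸m]≡n K≤k)) ⟩
    at (K + e) W                     ≡⟨ cong (at (K + e)) shape ⟩
    at (K + e) (take K w ++ u ++ rest) ≡⟨ at-++ʳ e (take K w) (u ++ rest) length-prefix ⟩
    at e (u ++ rest)                 ≡⟨ at-newSyms w rest e<ν ⟩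
    just (maxSym w + suc e)          ∎
    where
    open ≡-Reasoning
    e = k ∸ K
    e<ν : e < ν
    e<ν = subst (e <_) (m+n∸m≡n K ν) (∸-monoˡ-< k<K+ν K≤k)

  at-insert-old : ∀ i {b} → i < K → at i W ≡ just b → b ≤ maxSym w
  at-insert-old i {b} i<K eq = at-take⇒≤maxSym i K w (begin
    at i (take K w)              ≡⟨ sym (at-++ˡ i (take K w) (u ++ rest) i<length) ⟩
    at i (take K w ++ u ++ rest) ≡⟨ cong (at i) (sym shape) ⟩
    at i W                       ≡⟨ eq ⟩
    just b                       ∎)
    where
    open ≡-Reasoning
    i<length = subst (i <_) (sym length-prefix) i<K

  insert-freshBlock-unrepeated : ∀ i j → K ≤ j → j < K + ν → i < j → at i W ≢ at j W
  insert-freshBlock-unrepeated i j K≤j j<K+ν i<j eq = distinct (i <? K)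
    where
    atj = at-insert-fresh j K≤j j<K+ν

    distinct : Dec (i < K) → ⊥
    distinct (yes i<K) = m+1+n≰m (maxSym w) (at-insert-old i i<K (trans eq atj))
    distinct (no i≮K)  = <⇒≢ (∸-monoˡ-< i<j K≤i)
      (suc-injective (+-cancelˡ-≡ (maxSym w) _ _ (just-injective (trans (sym ati) (trans eq atj)))))
      where
      K≤i = ≮⇒≥ i≮K
      ati = at-insert-fresh i K≤i (<-trans i<j j<K+ν)

startInsertion≁nearbyInsertion : ∀ I₁ I₂ m L K ℓ w → K ≤ length w → L < K → K < suc m + L →
  ¬ (insert I₁ (suc m) 1 (suc L) w ∼ insert I₂ (suc m) (suc K) ℓ w)
startInsertion≁nearbyInsertion I₁ I₂ m L K ℓ w K≤n L<K K<p W₁∼W₂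
  with insertAtStart-repeats I₁ m L w (<⇒≤ (<-≤-trans L<K K≤n))
... | q , q<ν , repeated =
  insert-freshBlock-unrepeated I₂ (suc m) K ℓ w K≤n q (suc m + L) (<⇒≤ K<p) p<K+ν q<p
    (∼-preserves-repetition q (suc m + L) W₁∼W₂ repeated)
  where
  p<K+ν : suc m + L < K + suc m
  p<K+ν = subst (suc m + L <_) (+-comm (suc m) K) (+-monoʳ-< (suc m) L<K)
  q<p : q < suc m + L
  q<p = <-≤-trans q<ν (m≤m+n (suc m) L)

lemma3p6 : (w : Word) (n : ℕ) → DOW w → Ascending w → length w ≡ n →
    (ν : ℕ) → 1 ≤ ν →
    (I₁ I₂ : Kind) (k₁ ℓ₁ k₂ ℓ₂ : ℕ) →
    1 ≤ k₁ → k₁ ≤ ℓ₁ → ℓ₁ ≤ suc n →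
    1 ≤ k₂ → k₂ ≤ ℓ₂ → ℓ₂ ≤ suc n →
    insert I₁ ν k₁ ℓ₁ w ∼ insert I₂ ν k₂ ℓ₂ w →
    k₁ ≡ 1 → ℓ₂ ≡ suc n →
    k₁ ≤ ℓ₁ → ℓ₁ < k₂ → k₂ ≤ ℓ₂ →
    k₂ ∸ ℓ₁ ≥ ν
lemma3p6 w .(length w) _ _ refl (suc m) _ I₁ I₂ .1 (suc L) (suc K) ℓ₂ _ _ _ _ _ _ W₁∼W₂
  refl refl _ (s≤s L<K) k₂≤ℓ₂ with K <? suc m + L
... | yes K<p = contradiction W₁∼W₂
                  (startInsertion≁nearbyInsertion I₁ I₂ m L K ℓ₂ w (s≤s⁻¹ k₂≤ℓ₂) L<K K<p)
... | no K≮p  = m+n≤o⇒m≤o∸n (suc m) (≮⇒≥ K≮p)
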